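{- Let $n=2^t-1$ with $t>0$. There exists a one-to-one correspondence between the set of binary perfect single-error-correcting codes of length $n$ and the set of integer tilings $T\subseteq\mathbb{Z}^n$ with $\Upsilon_n$ in which every element of $T$ has only even entries.
   Context: A binary perfect (single-error-correcting) code of length $n$ is a set $C\subseteq\mathbb{Z}_2^n$ such that any two distinct codewords differ in at least $3$ positions (Hamming distance at least $3$) and every word of $\mathbb{Z}_2^n$ is at Hamming distance at most $1$ from some codeword. For $X,U\in\mathbb{Z}^n$ let $d_M(X,U)=\sum_i|x_i-u_i|$. Let $\Upsilon_n=\{U\in\mathbb{Z}^n: d_M(X,U)\le1\text{ for some }X\in\{ -1,0\}^n\}$. A set $T\subseteq\mathbb{Z}^n$ is an integer tiling with $\Upsilon_n$ if the translates $X+\Upsilon_n$, $X\in T$, partition $\mathbb{Z}^n$. -}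

module Defs where

open import Level using (0ℓ; suc)
open import Data.Bool using (Bool; true; false)
open import Data.Nat as ℕ using (ℕ; zero; _≤_)
open import Data.Integer as ℤ using (ℤ; +_; _-_; ∣_∣; -[1+_])
open import Data.Integer.Divisibility using () renaming (_∣_ to _∣ℤ_)
open import Data.Vec using (Vec; []; _∷_; zipWith)
open import Data.Vec.Relation.Unary.All using (All)
open import Data.Product using (Σ; ∃; _×_; _,_; proj₁; proj₂)
open import Data.Sum using (_⊎_)
open import Relation.Unary using (Pred; _∈_)
open import Relation.Binary.PropositionalEquality using (_≡_; _≢_)
open import Relation.Binary.Bundles using (Setoid)
open import Relation.Binary.Structures using (IsEquivalence)
open import Function using (id; _∘_)

Word : ℕ → Set
Word n = Vec Bool n

diff : Bool → Bool → ℕ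
diff true  true  = 0
diff false false = 0
diff _     _     = 1

hamming : ∀ {n} → Word n → Word n → ℕ
hamming []       []       = 0
hamming (a ∷ as) (b ∷ bs) = diff a b ℕ.+ hamming as bs

IsPerfectCode : ∀ n → Pred (Word n) 0ℓ → Set
IsPerfectCode n C =
  (∀ x y → x ∈ C → y ∈ C → x ≢ y → 3 ≤ hamming x y) ×
  (∀ w → ∃ λ c → c ∈ C × hamming w c ≤ 1)

Point : ℕ → Set
Point n = Vec ℤ n

dM : ∀ {n} → Point n → Point n → ℕ
dM []       []       = 0
dM (x ∷ xs) (u ∷ us) = ∣ x - u ∣ ℕ.+ dM xs us

Υ : ∀ n → Pred (Point n) 0ℓ
Υ n U = ∃ λ (X : Point n) → All (λ x → x ≡ -[1+ 0 ] ⊎ x ≡ + 0) X × dM X U ≤ 1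

_∈+Υ_ : ∀ {n} → Point n → Point n → Set
_∈+Υ_ {n} U X = zipWith _-_ U X ∈ Υ n

IsTiling : ∀ n → Pred (Point n) 0ℓ → Set
IsTiling n T =
  (∀ U → ∃ λ X → X ∈ T × U ∈+Υ X) ×
  (∀ U X Y → X ∈ T → Y ∈ T → U ∈+Υ X → U ∈+Υ Y → X ≡ Y)

AllEven : ∀ {n} → Point n → Set
AllEven X = All (λ x → + 2 ∣ℤ x) X

IsEvenTiling : ∀ n → Pred (Point n) 0ℓ → Set
IsEvenTiling n T = IsTiling n T × (∀ X → X ∈ T → AllEven X)

SameElems : ∀ {A : Set} → Pred A 0ℓ → Pred A 0ℓ → Set
SameElems P Q = (∀ x → P x → Q x) × (∀ x → Q x → P x)

subsetSetoid : (A : Set) → (Pred A 0ℓ → Set) → Setoid (suc 0ℓ) 0ℓ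
subsetSetoid A Prop = record
  { Carrier = Σ (Pred A 0ℓ) Prop
  ; _≈_ = λ P Q → SameElems (proj₁ P) (proj₁ Q)
  ; isEquivalence = record
    { refl = (λ _ → id) , (λ _ → id)
    ; sym = λ (f , g) → g , f
    ; trans = λ (f , g) (h , k) → (λ x → h x ∘ f x) , (λ x → g x ∘ k x)
    }
  }

PerfectCodes : ℕ → Setoid (suc 0ℓ) 0ℓ
PerfectCodes n = subsetSetoid (Word n) (IsPerfectCode n)

EvenTilings : ℕ → Setoid (suc 0ℓ) 0ℓ
EvenTilings n = subsetSetoid (Point n) (IsEvenTiling n)

module Submission where

-- Even translation vectors are written 2J, and an arbitrary point U as the
-- "corner" U = 2K - b with K ∈ ℤⁿ and b ∈ {0,1}ⁿ.  A direct computation shows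
-- that U ∈ 2J + Υₙ iff J is a b-neighbour of K: either J = K, or J = K + σ(b_m) e_m
-- for one coordinate m, where σ(1) = -1 and σ(0) = +1.  So an even tiling T is the
-- same as a set L = T/2 ⊆ ℤⁿ meeting every neighbourhood N(K,b) exactly once
-- (a half-tiling).  The parity word of a b-neighbour of K is within Hamming
-- distance 1 of the parity word of K, every word at distance ≤ 1 occurs, and it
-- determines the neighbour.  Hence for a perfect code C the set C + 2ℤⁿ of vectors
-- with parity word in C is a half-tiling.  Conversely every half-tiling L is
-- invariant under ±2 shifts of single coordinates (a "flip" argument on two
-- neighbourhoods), so L = C + 2ℤⁿ for the code C = L ∩ {0,1}ⁿ, which is perfect.
-- The maps C ↦ 2(C + 2ℤⁿ) and T ↦ (T/2) ∩ {0,1}ⁿ are therefore inverse to each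
-- other; the argument works for every length n.

open import Defs
open import Data.Nat using (ℕ; _<_; _^_; _∸_)
open import Function.Bundles using (Bijection)

open import Level using (0ℓ)
open import Data.Bool using (Bool; true; false; not)
import Data.Bool as Bool
open import Data.Bool.Properties using (not-¬)
open import Data.Nat as ℕ using (zero; suc; z≤n; s≤s; s≤s⁻¹)
import Data.Nat.Properties as ℕP
open import Algebra.Properties.CommutativeSemigroup ℕP.+-commutativeSemigroup
  using () renaming (interchange to +-interchange)
open import Data.Integer using (ℤ; +_; -[1+_]; _+_; _-_; _*_; -_; ∣_∣)
import Data.Integer.Properties as ℤP
open import Data.Integer.DivMod using (_%_; _/_; n%d<d; a≡a%n+[a/n]*n)
import Data.Integer.Divisibility.Signed as Signed
open import Data.Integer.Tactic.RingSolver using (solve-∀)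
open import Data.Fin using (Fin; zero; suc)
import Data.Fin.Properties as FinP
open import Data.Vec using (Vec; []; _∷_; map; zipWith; lookup; replicate; updateAt)
import Data.Vec.Properties as VecP
open import Data.Vec.Relation.Unary.All using (All; []; _∷_)
open import Data.Product using (Σ; ∃; _×_; _,_; proj₁; proj₂)
open import Data.Sum using (_⊎_; inj₁; inj₂)
open import Data.Empty using (⊥-elim)
open import Data.Unit using (⊤; tt)
open import Function using (_∘_)
open import Relation.Nullary using (yes; no)
open import Relation.Unary using (Pred)
open import Relation.Binary.PropositionalEquality
  using (_≡_; _≢_; refl; sym; trans; cong; cong₂; subst; subst₂; module ≡-Reasoning)

bit : Bool → ℤ
bit false = + 0
bit true  = + 1

-- The unit step σ(β): the point 2k - bit β lies in the translates 2J + Υ with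
-- J = k and J = k + σ(β).
step : Bool → ℤ
step false = + 1
step true  = -[1+ 0 ]

twice≢one : ∀ m → 2 ℕ.* m ≢ 1
twice≢one zero          ()
twice≢one (suc zero)    ()
twice≢one (suc (suc m)) ()

private
  double-diff : ∀ q r → + 2 * (q - r) ≡ + 2 * q - + 2 * r
  double-diff = solve-∀
  odd-minus : ∀ r → + 1 + + 2 * r - + 2 * r ≡ + 1
  odd-minus = solve-∀
  cancel-left : ∀ c q → + 2 * q ≡ c + + 2 * q - c
  cancel-left = solve-∀

even≢odd : ∀ q r → + 2 * q ≢ + 1 + + 2 * r
even≢odd q r e = twice≢one ∣ q - r ∣ (begin
  2 ℕ.* ∣ q - r ∣              ≡⟨ sym (ℤP.abs-* (+ 2) (q - r)) ⟩
  ∣ + 2 * (q - r) ∣            ≡⟨ cong ∣_∣ (double-diff q r) ⟩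
  ∣ + 2 * q - + 2 * r ∣        ≡⟨ cong (λ z → ∣ z - + 2 * r ∣) e ⟩
  ∣ + 1 + + 2 * r - + 2 * r ∣  ≡⟨ cong ∣_∣ (odd-minus r) ⟩
  1                            ∎)
  where open ≡-Reasoning

halves-equal : ∀ c q r → c + + 2 * q ≡ c + + 2 * r → q ≡ r
halves-equal c q r e = ℤP.*-cancelˡ-≡ (+ 2) q r
  (trans (cancel-left c q) (trans (cong (_- c) e) (sym (cancel-left c r))))

split-unique : ∀ β γ q r → bit β + + 2 * q ≡ bit γ + + 2 * r → β ≡ γ × q ≡ r
split-unique false false q r e = refl , halves-equal (+ 0) q r e
split-unique true  true  q r e = refl , halves-equal (+ 1) q r e
split-unique false true  q r e = ⊥-elim (even≢odd q r (trans (sym (ℤP.+-identityˡ _)) e))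
split-unique true  false q r e = ⊥-elim (even≢odd r q (trans (sym (ℤP.+-identityˡ _)) (sym e)))

split : ∀ j → Σ Bool λ β → Σ ℤ λ q → j ≡ bit β + + 2 * q
split j with j % + 2 | n%d<d j (+ 2) | a≡a%n+[a/n]*n j (+ 2)
... | 0 | _ | e = false , j / + 2 , trans e (cong (λ z → bit false + z) (ℤP.*-comm (j / + 2) (+ 2)))
... | 1 | _ | e = true  , j / + 2 , trans e (cong (λ z → bit true + z) (ℤP.*-comm (j / + 2) (+ 2)))
... | suc (suc _) | s≤s (s≤s ()) | _

odd : ℤ → Bool
odd j = proj₁ (split j)

half : ℤ → ℤ
half j = proj₁ (proj₂ (split j))

odd+half : ∀ j → j ≡ bit (odd j) + + 2 * half j
odd+half j = proj₂ (proj₂ (split j))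

odd-split : ∀ β q → odd (bit β + + 2 * q) ≡ β
odd-split β q = proj₁ (split-unique _ β _ q (sym (odd+half (bit β + + 2 * q))))

private
  step-true-odd : ∀ h → + 1 + + 2 * h + -[1+ 0 ] ≡ + 0 + + 2 * h
  step-true-odd = solve-∀
  step-false-odd : ∀ h → + 1 + + 2 * h + + 1 ≡ + 0 + + 2 * (h + + 1)
  step-false-odd = solve-∀
  step-true-even : ∀ h → + 0 + + 2 * h + -[1+ 0 ] ≡ + 1 + + 2 * (h - + 1)
  step-true-even = solve-∀
  step-false-even : ∀ h → + 0 + + 2 * h + + 1 ≡ + 1 + + 2 * h
  step-false-even = solve-∀

step-split : ∀ p β h → Σ ℤ λ h' → bit p + + 2 * h + step β ≡ bit (not p) + + 2 * h'
step-split true  true  h = h , step-true-odd h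
step-split true  false h = h + + 1 , step-false-odd h
step-split false true  h = h - + 1 , step-true-even h
step-split false false h = h , step-false-even h

odd-step : ∀ j β → odd (j + step β) ≡ not (odd j)
odd-step j β with step-split (odd j) β (half j)
... | h' , e = trans (cong odd (trans (cong (_+ step β) (odd+half j)) e)) (odd-split (not (odd j)) h')

step≢0 : ∀ j β → j + step β ≢ j
step≢0 j β e = not-¬ (cong odd e) (odd-step j β)

private
  shift-by-halves : ∀ c a b → c + + 2 * b ≡ (c + + 2 * a) + + 2 * (b - a)
  shift-by-halves = solve-∀

same-parity : ∀ x y → odd x ≡ odd y → Σ ℤ λ q → y ≡ x + + 2 * q
same-parity x y e = half y - half x , (begin
  y                                                      ≡⟨ odd+half y ⟩
  bit (odd y) + + 2 * half y                             ≡⟨ cong (λ β → bit β + + 2 * half y) (sym e) ⟩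
  bit (odd x) + + 2 * half y                             ≡⟨ shift-by-halves (bit (odd x)) (half x) (half y) ⟩
  (bit (odd x) + + 2 * half x) + + 2 * (half y - half x) ≡⟨ cong (_+ + 2 * (half y - half x)) (sym (odd+half x)) ⟩
  x + + 2 * (half y - half x)                            ∎)
  where open ≡-Reasoning

diff-self : ∀ a → diff a a ≡ 0
diff-self true  = refl
diff-self false = refl

diff≤1 : ∀ a b → diff a b ℕ.≤ 1
diff≤1 true  true  = z≤n
diff≤1 true  false = s≤s z≤n
diff≤1 false true  = s≤s z≤n
diff≤1 false false = z≤n

diff-sym : ∀ a b → diff a b ≡ diff b a
diff-sym true  true  = refl
diff-sym true  false = refl
diff-sym false true  = refl
diff-sym false false = refl

diff-triangle : ∀ a b c → diff a c ℕ.≤ diff a b ℕ.+ diff b c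
diff-triangle true  true  c     = ℕP.≤-refl
diff-triangle false false c     = ℕP.≤-refl
diff-triangle true  false true  = z≤n
diff-triangle true  false false = s≤s z≤n
diff-triangle false true  true  = s≤s z≤n
diff-triangle false true  false = z≤n

hamming-self : ∀ {n} (w : Word n) → hamming w w ≡ 0
hamming-self []      = refl
hamming-self (a ∷ w) = cong₂ ℕ._+_ (diff-self a) (hamming-self w)

hamming-sym : ∀ {n} (u v : Word n) → hamming u v ≡ hamming v u
hamming-sym []      []      = refl
hamming-sym (a ∷ u) (b ∷ v) = cong₂ ℕ._+_ (diff-sym a b) (hamming-sym u v)

hamming-triangle : ∀ {n} (u v w : Word n) → hamming u w ℕ.≤ hamming u v ℕ.+ hamming v w
hamming-triangle []      []      []      = z≤n
hamming-triangle (a ∷ u) (b ∷ v) (c ∷ w) = begin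
  diff a c ℕ.+ hamming u w                                   ≤⟨ ℕP.+-mono-≤ (diff-triangle a b c) (hamming-triangle u v w) ⟩
  (diff a b ℕ.+ diff b c) ℕ.+ (hamming u v ℕ.+ hamming v w) ≡⟨ +-interchange (diff a b) (diff b c) (hamming u v) (hamming v w) ⟩
  (diff a b ℕ.+ hamming u v) ℕ.+ (diff b c ℕ.+ hamming v w) ∎
  where open ℕP.≤-Reasoning

hamming≡0 : ∀ {n} (u v : Word n) → hamming u v ≡ 0 → u ≡ v
hamming≡0 []      []      _ = refl
hamming≡0 (a ∷ u) (b ∷ v) e =
  cong₂ _∷_ (diff≡0 a b (ℕP.m+n≡0⇒m≡0 _ e)) (hamming≡0 u v (ℕP.m+n≡0⇒n≡0 _ e))
  where diff≡0 : ∀ a b → diff a b ≡ 0 → a ≡ b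
        diff≡0 true  true  _ = refl
        diff≡0 false false _ = refl

unit-ball-cons : ∀ {n} a c (u v : Word n) → hamming (a ∷ u) (c ∷ v) ℕ.≤ 1 →
                 (a ≡ c × hamming u v ℕ.≤ 1) ⊎ (c ≡ not a × u ≡ v)
unit-ball-cons true  true  u v h = inj₁ (refl , h)
unit-ball-cons false false u v h = inj₁ (refl , h)
unit-ball-cons true  false u v h = inj₂ (refl , hamming≡0 u v (ℕP.n≤0⇒n≡0 (s≤s⁻¹ h)))
unit-ball-cons false true  u v h = inj₂ (refl , hamming≡0 u v (ℕP.n≤0⇒n≡0 (s≤s⁻¹ h)))

midpoint : ∀ {n} (x y : Word n) → hamming x y ℕ.≤ 2 →
           Σ (Word n) λ m → hamming m x ℕ.≤ 1 × hamming m y ℕ.≤ 1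
midpoint []      []      _ = [] , z≤n , z≤n
midpoint (true  ∷ x) (true  ∷ y) h with midpoint x y h
... | m , mx , my = true ∷ m , mx , my
midpoint (false ∷ x) (false ∷ y) h with midpoint x y h
... | m , mx , my = false ∷ m , mx , my
midpoint (true  ∷ x) (false ∷ y) h =
  true ∷ y , subst (ℕ._≤ 1) (hamming-sym x y) (s≤s⁻¹ h) , s≤s (ℕP.≤-reflexive (hamming-self y))
midpoint (false ∷ x) (true  ∷ y) h =
  false ∷ y , subst (ℕ._≤ 1) (hamming-sym x y) (s≤s⁻¹ h) , s≤s (ℕP.≤-reflexive (hamming-self y))

double : ∀ {n} → Vec ℤ n → Point n
double = map (+ 2 *_)

bits : ∀ {n} → Word n → Vec ℤ n
bits = map bit

parity : ∀ {n} → Vec ℤ n → Word n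
parity = map odd

corner : ∀ {n} → Vec ℤ n → Word n → Point n
corner = zipWith (λ k β → + 2 * k - bit β)

parity-bits : ∀ {n} (w : Word n) → parity (bits w) ≡ w
parity-bits []      = refl
parity-bits (β ∷ w) =
  cong₂ _∷_ (trans (cong odd (sym (ℤP.+-identityʳ (bit β)))) (odd-split β (+ 0))) (parity-bits w)

double-injective : ∀ {n} (J J' : Vec ℤ n) → double J ≡ double J' → J ≡ J'
double-injective []      []        _ = refl
double-injective (j ∷ J) (j' ∷ J') e =
  cong₂ _∷_ (ℤP.*-cancelˡ-≡ (+ 2) j j' (VecP.∷-injectiveˡ e)) (double-injective J J' (VecP.∷-injectiveʳ e))

double-even : ∀ {n} (J : Vec ℤ n) → AllEven (double J)
double-even []      = []
double-even (j ∷ J) = Signed.∣⇒∣ᵤ (Signed.divides j (ℤP.*-comm (+ 2) j)) ∷ double-even J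

even-double : ∀ {n} (X : Point n) → AllEven X → Σ (Vec ℤ n) λ J → X ≡ double J
even-double []      []        = [] , refl
even-double (x ∷ X) (2∣x ∷ E) with Signed.∣ᵤ⇒∣ 2∣x | even-double X E
... | Signed.divides j x≡j*2 | J , X≡2J = j ∷ J , cong₂ _∷_ (trans x≡j*2 (ℤP.*-comm j (+ 2))) X≡2J

private
  even-corner : ∀ h → bit false + + 2 * h ≡ + 2 * h - bit false
  even-corner = solve-∀
  odd-corner : ∀ h → bit true + + 2 * h ≡ + 2 * (h + + 1) - bit true
  odd-corner = solve-∀

corner-cover : ∀ {n} (U : Point n) → Σ (Vec ℤ n) λ K → Σ (Word n) λ b → U ≡ corner K b
corner-cover []      = [] , [] , refl
corner-cover (u ∷ U) with split u | corner-cover U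
... | false , h , e | K , b , E = h ∷ K         , false ∷ b , cong₂ _∷_ (trans e (even-corner h)) E
... | true  , h , e | K , b , E = (h + + 1) ∷ K , true  ∷ b , cong₂ _∷_ (trans e (odd-corner h)) E

Neighbour : ∀ {n} → Vec ℤ n → Word n → Vec ℤ n → Set
Neighbour []      []      []      = ⊤
Neighbour (k ∷ K) (β ∷ b) (j ∷ J) = (j ≡ k × Neighbour K b J) ⊎ (j ≡ k + step β × J ≡ K)

neighbour-refl : ∀ {n} (K : Vec ℤ n) b → Neighbour K b K
neighbour-refl []      []      = tt
neighbour-refl (k ∷ K) (β ∷ b) = inj₁ (refl , neighbour-refl K b)

neighbour-at : ∀ {n} (K : Vec ℤ n) b i → Neighbour K b (updateAt K i (_+ step (lookup b i)))
neighbour-at (k ∷ K) (β ∷ b) zero    = inj₂ (refl , refl)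
neighbour-at (k ∷ K) (β ∷ b) (suc i) = inj₁ (refl , neighbour-at K b i)

neighbour-cases : ∀ {n} (K : Vec ℤ n) b J → Neighbour K b J →
                  J ≡ K ⊎ Σ (Fin n) λ m → J ≡ updateAt K m (_+ step (lookup b m))
neighbour-cases []      []      []      _ = inj₁ refl
neighbour-cases (k ∷ K) (β ∷ b) (j ∷ J) (inj₂ (refl , refl)) = inj₂ (zero , refl)
neighbour-cases (k ∷ K) (β ∷ b) (j ∷ J) (inj₁ (refl , N)) with neighbour-cases K b J N
... | inj₁ J≡K       = inj₁ (cong (k ∷_) J≡K)
... | inj₂ (m , J≡)  = inj₂ (suc m , cong (k ∷_) J≡)

Cube : ℤ → Set
Cube x = x ≡ -[1+ 0 ] ⊎ x ≡ + 0

vertex : ∀ {n} → Word n → Point n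
vertex = map (λ β → - bit β)

cube-vertex : ∀ β → Cube (- bit β)
cube-vertex true  = inj₁ refl
cube-vertex false = inj₂ refl

vertex-in-cube : ∀ {n} (b : Word n) → All Cube (vertex b)
vertex-in-cube []      = []
vertex-in-cube (β ∷ b) = cube-vertex β ∷ vertex-in-cube b

private
  centre-offset : ∀ k c → - c - (+ 2 * k - c - + 2 * k) ≡ + 0
  centre-offset = solve-∀
  moved-offset-true : ∀ k → + 0 - (+ 2 * k - + 1 - + 2 * (k + -[1+ 0 ])) ≡ -[1+ 0 ]
  moved-offset-true = solve-∀
  moved-offset-false : ∀ k → -[1+ 0 ] - (+ 2 * k - + 0 - + 2 * (k + + 1)) ≡ + 1
  moved-offset-false = solve-∀

vertex-distance : ∀ {n} (K : Vec ℤ n) b → dM (vertex b) (zipWith _-_ (corner K b) (double K)) ≡ 0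
vertex-distance []      []      = refl
vertex-distance (k ∷ K) (β ∷ b) rewrite centre-offset k (bit β) = vertex-distance K b

moved-distance : ∀ k β → ∣ - bit (not β) - (+ 2 * k - bit β - + 2 * (k + step β)) ∣ ≡ 1
moved-distance k true  = cong ∣_∣ (moved-offset-true k)
moved-distance k false = cong ∣_∣ (moved-offset-false k)

neighbour⇒member : ∀ {n} (K : Vec ℤ n) b J → Neighbour K b J → corner K b ∈+Υ double J
neighbour⇒member []      []      []      _ = [] , [] , z≤n
neighbour⇒member (k ∷ K) (β ∷ b) (j ∷ J) (inj₁ (refl , N)) with neighbour⇒member K b J N
... | X , X∈cube , X-close =
  - bit β ∷ X , cube-vertex β ∷ X∈cube ,
  subst (λ z → ∣ z ∣ ℕ.+ _ ℕ.≤ 1) (sym (centre-offset k (bit β))) X-close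
neighbour⇒member (k ∷ K) (β ∷ b) (j ∷ J) (inj₂ (refl , refl)) =
  - bit (not β) ∷ vertex b , cube-vertex (not β) ∷ vertex-in-cube b ,
  subst₂ (λ u v → u ℕ.+ v ℕ.≤ 1) (sym (moved-distance k β)) (sym (vertex-distance K b)) (s≤s z≤n)

private
  offset-identity : ∀ x k j c → x - (+ 2 * k - c - + 2 * j) - x ≡ c + + 2 * (j - k)
  offset-identity = solve-∀
  add-difference : ∀ k j → j ≡ k + (j - k)
  add-difference = solve-∀

offset : ∀ x k j β e → x - (+ 2 * k - bit β - + 2 * j) ≡ e → bit β + + 2 * (j - k) ≡ e - x
offset x k j β e eq = trans (sym (offset-identity x k j (bit β))) (cong (_- x) eq)

stays : ∀ k j β γ → bit β + + 2 * (j - k) ≡ bit γ + + 2 * + 0 → j ≡ k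
stays k j β γ e =
  trans (add-difference k j) (trans (cong (λ d → k + d) (proj₂ (split-unique β γ _ _ e))) (ℤP.+-identityʳ k))

moves : ∀ k j β γ → bit β + + 2 * (j - k) ≡ bit γ + + 2 * step γ → j ≡ k + step β
moves k j β γ e with split-unique β γ _ _ e
... | refl , d = trans (add-difference k j) (cong (λ d → k + d) d)

abs≡1 : ∀ y → ∣ y ∣ ≡ 1 → y ≡ + 1 ⊎ y ≡ -[1+ 0 ]
abs≡1 (+ 1)      _ = inj₁ refl
abs≡1 -[1+ 0 ]   _ = inj₂ refl

coordinate₀ : ∀ {x} k j β → Cube x → ∣ x - (+ 2 * k - bit β - + 2 * j) ∣ ≡ 0 → j ≡ k
coordinate₀ k j β (inj₁ refl) d = stays k j β true  (offset -[1+ 0 ] k j β (+ 0) (ℤP.∣i∣≡0⇒i≡0 d))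
coordinate₀ k j β (inj₂ refl) d = stays k j β false (offset (+ 0) k j β (+ 0) (ℤP.∣i∣≡0⇒i≡0 d))

coordinate₁ : ∀ {x} k j β → Cube x → ∣ x - (+ 2 * k - bit β - + 2 * j) ∣ ≡ 1 → j ≡ k ⊎ j ≡ k + step β
coordinate₁ {x} k j β cube d with abs≡1 (x - (+ 2 * k - bit β - + 2 * j)) d | cube
... | inj₁ e | inj₁ refl = inj₂ (moves k j β false (offset -[1+ 0 ] k j β (+ 1) e))
... | inj₁ e | inj₂ refl = inj₁ (stays k j β true  (offset (+ 0) k j β (+ 1) e))
... | inj₂ e | inj₁ refl = inj₁ (stays k j β false (offset -[1+ 0 ] k j β -[1+ 0 ] e))
... | inj₂ e | inj₂ refl = inj₂ (moves k j β true  (offset (+ 0) k j β -[1+ 0 ] e))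

sum≤1 : ∀ a r → a ℕ.+ r ℕ.≤ 1 → (a ≡ 0 × r ℕ.≤ 1) ⊎ (a ≡ 1 × r ≡ 0)
sum≤1 zero          r h         = inj₁ (refl , h)
sum≤1 (suc zero)    zero h      = inj₂ (refl , refl)
sum≤1 (suc zero)    (suc r) (s≤s ())
sum≤1 (suc (suc a)) r (s≤s ())

centred : ∀ {n} (K : Vec ℤ n) b J X → All Cube X → dM X (zipWith _-_ (corner K b) (double J)) ≡ 0 → J ≡ K
centred []      []      []      []      []          _ = refl
centred (k ∷ K) (β ∷ b) (j ∷ J) (x ∷ X) (cx ∷ cube) d =
  cong₂ _∷_ (coordinate₀ k j β cx (ℕP.m+n≡0⇒m≡0 _ d)) (centred K b J X cube (ℕP.m+n≡0⇒n≡0 _ d))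

member⇒neighbour : ∀ {n} (K : Vec ℤ n) b J → corner K b ∈+Υ double J → Neighbour K b J
member⇒neighbour []      []      []      _ = tt
member⇒neighbour (k ∷ K) (β ∷ b) (j ∷ J) (x ∷ X , cx ∷ cube , close) with sum≤1 _ _ close
... | inj₁ (d₀ , rest) = inj₁ (coordinate₀ k j β cx d₀ , member⇒neighbour K b J (X , cube , rest))
... | inj₂ (d₁ , rest) with centred K b J X cube rest | coordinate₁ k j β cx d₁
...   | J≡K | inj₁ j≡k = inj₁ (j≡k , subst (Neighbour K b) (sym J≡K) (neighbour-refl K b))
...   | J≡K | inj₂ j≡k+σ = inj₂ (j≡k+σ , J≡K)

HalfTiling : ∀ n → Pred (Vec ℤ n) 0ℓ → Set
HalfTiling n L =
  (∀ K b → Σ (Vec ℤ n) λ J → L J × Neighbour K b J) ×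
  (∀ K b J J' → L J → L J' → Neighbour K b J → Neighbour K b J' → J ≡ J')

Doubled : ∀ {n} → Pred (Vec ℤ n) 0ℓ → Pred (Point n) 0ℓ
Doubled {n} L X = Σ (Vec ℤ n) λ J → L J × X ≡ double J

Halved : ∀ {n} → Pred (Point n) 0ℓ → Pred (Vec ℤ n) 0ℓ
Halved T J = T (double J)

same-trans : ∀ {A : Set} {P Q R : Pred A 0ℓ} → SameElems P Q → SameElems Q R → SameElems P R
same-trans (P⊆Q , Q⊆P) (Q⊆R , R⊆Q) = (λ x → Q⊆R x ∘ P⊆Q x) , (λ x → Q⊆P x ∘ R⊆Q x)

doubled-cong : ∀ {n} {L L' : Pred (Vec ℤ n) 0ℓ} → SameElems L L' → SameElems (Doubled L) (Doubled L')
doubled-cong (L⊆L' , L'⊆L) =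
  (λ X (J , LJ , X≡2J) → J , L⊆L' J LJ , X≡2J) , (λ X (J , LJ , X≡2J) → J , L'⊆L J LJ , X≡2J)

doubled-tiling : ∀ {n} (L : Pred (Vec ℤ n) 0ℓ) → HalfTiling n L → IsEvenTiling n (Doubled L)
doubled-tiling {n} L (cover , unique) =
  (covering , disjoint) , λ X (J , _ , X≡2J) → subst AllEven (sym X≡2J) (double-even J)
  where
  covering : ∀ U → ∃ λ X → Doubled L X × U ∈+Υ X
  covering U with corner-cover U
  ... | K , b , U≡ with cover K b
  ... | J , LJ , N = double J , (J , LJ , refl) , subst (_∈+Υ double J) (sym U≡) (neighbour⇒member K b J N)
  disjoint : ∀ U X Y → Doubled L X → Doubled L Y → U ∈+Υ X → U ∈+Υ Y → X ≡ Y
  disjoint U X Y (J , LJ , refl) (J' , LJ' , refl) U∈X U∈Y with corner-cover U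
  ... | K , b , refl =
    cong double (unique K b J J' LJ LJ' (member⇒neighbour K b J U∈X) (member⇒neighbour K b J' U∈Y))

halved-tiling : ∀ {n} (T : Pred (Point n) 0ℓ) → IsEvenTiling n T → HalfTiling n (Halved T)
halved-tiling T ((covering , disjoint) , even) = cover , unique
  where
  cover : ∀ K b → ∃ λ J → Halved T J × Neighbour K b J
  cover K b with covering (corner K b)
  ... | X , TX , U∈X with even-double X (even X TX)
  ... | J , refl = J , TX , member⇒neighbour K b J U∈X
  unique : ∀ K b J J' → Halved T J → Halved T J' → Neighbour K b J → Neighbour K b J' → J ≡ J'
  unique K b J J' TJ TJ' N N' = double-injective J J'
    (disjoint (corner K b) _ _ TJ TJ' (neighbour⇒member K b J N) (neighbour⇒member K b J' N'))

doubled-halved : ∀ {n} (T : Pred (Point n) 0ℓ) → IsEvenTiling n T → SameElems (Doubled (Halved T)) T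
doubled-halved T (_ , even) = (λ X (J , TJ , X≡2J) → subst T (sym X≡2J) TJ) , halve
  where
  halve : ∀ X → T X → Doubled (Halved T) X
  halve X TX with even-double X (even X TX)
  ... | J , refl = J , TX , refl

neighbour-parity : ∀ {n} (K : Vec ℤ n) b J → Neighbour K b J → hamming (parity K) (parity J) ℕ.≤ 1
neighbour-parity []      []      []      _ = z≤n
neighbour-parity (k ∷ K) (β ∷ b) (j ∷ J) (inj₁ (refl , N))
  rewrite diff-self (odd k) = neighbour-parity K b J N
neighbour-parity (k ∷ K) (β ∷ b) (j ∷ J) (inj₂ (refl , refl))
  rewrite hamming-self (parity K) | ℕP.+-identityʳ (diff (odd k) (odd (k + step β))) = diff≤1 _ _

neighbour-with-parity : ∀ {n} (K : Vec ℤ n) b w → hamming (parity K) w ℕ.≤ 1 →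
                        Σ (Vec ℤ n) λ J → Neighbour K b J × parity J ≡ w
neighbour-with-parity []      []      []      _ = [] , tt , refl
neighbour-with-parity (k ∷ K) (β ∷ b) (ω ∷ w) h with unit-ball-cons (odd k) ω (parity K) w h
... | inj₁ (refl , h') with neighbour-with-parity K b w h'
...   | J , N , refl = k ∷ J , inj₁ (refl , N) , refl
neighbour-with-parity (k ∷ K) (β ∷ b) (ω ∷ w) h | inj₂ (refl , refl) =
  k + step β ∷ K , inj₂ (refl , refl) , cong (_∷ parity K) (odd-step k β)

neighbour-determined : ∀ {n} (K : Vec ℤ n) b J J' → Neighbour K b J → Neighbour K b J' →
                       parity J ≡ parity J' → J ≡ J'
neighbour-determined []      []      []      []        _ _ _ = refl
neighbour-determined (k ∷ K) (β ∷ b) (j ∷ J) (j' ∷ J') (inj₁ (refl , N)) (inj₁ (refl , N')) e =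
  cong (k ∷_) (neighbour-determined K b J J' N N' (VecP.∷-injectiveʳ e))
neighbour-determined (k ∷ K) (β ∷ b) (j ∷ J) (j' ∷ J') (inj₂ (refl , refl)) (inj₂ (refl , refl)) e = refl
neighbour-determined (k ∷ K) (β ∷ b) (j ∷ J) (j' ∷ J') (inj₁ (refl , _)) (inj₂ (refl , _)) e =
  ⊥-elim (not-¬ (sym (VecP.∷-injectiveˡ e)) (odd-step k β))
neighbour-determined (k ∷ K) (β ∷ b) (j ∷ J) (j' ∷ J') (inj₂ (refl , _)) (inj₁ (refl , _)) e =
  ⊥-elim (not-¬ (VecP.∷-injectiveˡ e) (odd-step k β))

Lift : ∀ {n} → Pred (Word n) 0ℓ → Pred (Vec ℤ n) 0ℓ
Lift C J = C (parity J)

lift-cong : ∀ {n} {C C' : Pred (Word n) 0ℓ} → SameElems C C' → SameElems (Lift C) (Lift C')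
lift-cong (C⊆C' , C'⊆C) = (λ J → C⊆C' (parity J)) , (λ J → C'⊆C (parity J))

-- The lift of a perfect code is a half-tiling: a neighbourhood of K contains a
-- lifted codeword for each codeword within distance 1 of parity K, and there is
-- exactly one such codeword.
lift-halfTiling : ∀ {n} (C : Pred (Word n) 0ℓ) → IsPerfectCode n C → HalfTiling n (Lift C)
lift-halfTiling {n} C (separated , covering) = cover , unique
  where
  cover : ∀ K b → Σ (Vec ℤ n) λ J → Lift C J × Neighbour K b J
  cover K b with covering (parity K)
  ... | c , Cc , close with neighbour-with-parity K b c close
  ... | J , N , refl = J , Cc , N
  unique : ∀ K b J J' → Lift C J → Lift C J' → Neighbour K b J → Neighbour K b J' → J ≡ J'
  unique K b J J' CJ CJ' N N' with VecP.≡-dec Bool._≟_ (parity J) (parity J')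
  ... | yes same = neighbour-determined K b J J' N N' same
  ... | no differ = ⊥-elim (ℕP.<⇒≱ (s≤s within-two) (separated _ _ CJ CJ' differ))
    where
    within-two : hamming (parity J) (parity J') ℕ.≤ 2
    within-two = ℕP.≤-trans (hamming-triangle (parity J) (parity K) (parity J'))
      (ℕP.+-mono-≤ (subst (ℕ._≤ 1) (hamming-sym (parity K) (parity J)) (neighbour-parity K b J N))
                   (neighbour-parity K b J' N'))

stepped-coordinate : ∀ {n} (K V : Vec ℤ n) i β → updateAt K i (_+ step β) ≡ V → lookup V i ≢ lookup K i
stepped-coordinate K V i β refl same = step≢0 (lookup K i) β (trans (sym (VecP.lookup∘updateAt i K)) same)

-- Flip: the neighbourhoods of K for b and for b with the bit at i flipped differ
-- only in the step along i.  So if L meets the first one in the step along i, it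
-- cannot meet the second one elsewhere, and meets it in the other step along i.
flip : ∀ {n} {L : Pred (Vec ℤ n) 0ℓ} → HalfTiling n L → ∀ K b i →
       L (updateAt K i (_+ step (lookup b i))) → L (updateAt K i (_+ step (not (lookup b i))))
flip {L = L} (cover , unique) K b i LJ with cover K (updateAt b i not)
... | J' , LJ' , N' with neighbour-cases K (updateAt b i not) J' N'
... | inj₁ J'≡K = ⊥-elim (stepped-coordinate K K i (lookup b i)
        (unique K b _ K LJ (subst L J'≡K LJ') (neighbour-at K b i) (neighbour-refl K b)) refl)
... | inj₂ (m , J'≡) with m FinP.≟ i
...   | yes refl = subst L (trans J'≡ (cong (λ β → updateAt K m (_+ step β)) (VecP.lookup∘updateAt m b))) LJ'
...   | no m≢i = ⊥-elim (stepped-coordinate K J' i (lookup b i)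
          (unique K b _ J' LJ LJ' (neighbour-at K b i) J'-neighbour) J'-unmoved-at-i)
  where
  J'≡b-step : J' ≡ updateAt K m (_+ step (lookup b m))
  J'≡b-step = trans J'≡ (cong (λ β → updateAt K m (_+ step β)) (VecP.lookup∘updateAt′ m i m≢i b))
  J'-neighbour : Neighbour K b J'
  J'-neighbour = subst (Neighbour K b) (sym J'≡b-step) (neighbour-at K b m)
  J'-unmoved-at-i : lookup J' i ≡ lookup K i
  J'-unmoved-at-i = trans (cong (λ V → lookup V i) J'≡) (VecP.lookup∘updateAt′ i m (m≢i ∘ sym) K)

private
  step-back : ∀ x s → x - s + s ≡ x
  step-back = solve-∀
  jump-true : ∀ x → x - -[1+ 0 ] + + 1 ≡ x + + 2
  jump-true = solve-∀
  jump-false : ∀ x → x - + 1 + -[1+ 0 ] ≡ x - + 2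
  jump-false = solve-∀

-- Applying flip to K = J - σ(β) e_i and b = (β,…,β): L is invariant under moving one
-- coordinate by σ(¬β) - σ(β).
jump : ∀ {n} {L : Pred (Vec ℤ n) 0ℓ} → HalfTiling n L → ∀ β i J →
       L J → L (updateAt J i (λ x → x - step β + step (not β)))
jump {n} {L} tiles β i J LJ = subst L landed (flip tiles K b i (subst L (sym start) LJ))
  where
  K : Vec ℤ n
  K = updateAt J i (_- step β)
  b : Word n
  b = replicate n β
  start : updateAt K i (_+ step (lookup b i)) ≡ J
  start rewrite VecP.lookup-replicate i β =
    trans (VecP.updateAt-updateAt i J) (VecP.updateAt-id-local i J (step-back (lookup J i) (step β)))
  landed : updateAt K i (_+ step (not (lookup b i))) ≡ updateAt J i (λ x → x - step β + step (not β))
  landed rewrite VecP.lookup-replicate i β = VecP.updateAt-updateAt i J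

jump-up : ∀ {n} {L : Pred (Vec ℤ n) 0ℓ} → HalfTiling n L → ∀ i J → L J → L (updateAt J i (_+ + 2))
jump-up {L = L} tiles i J LJ =
  subst L (VecP.updateAt-cong-local i J (jump-true (lookup J i))) (jump tiles true i J LJ)

jump-down : ∀ {n} {L : Pred (Vec ℤ n) 0ℓ} → HalfTiling n L → ∀ i J → L J → L (updateAt J i (_- + 2))
jump-down {L = L} tiles i J LJ =
  subst L (VecP.updateAt-cong-local i J (jump-false (lookup J i))) (jump tiles false i J LJ)

private
  no-shift : ∀ x → x ≡ x + + 2 * + 0
  no-shift = solve-∀
  shift-up : ∀ x y → x + + 2 * y + + 2 ≡ x + + 2 * (+ 1 + y)
  shift-up = solve-∀
  shift-down : ∀ x y → x + + 2 * (- y) - + 2 ≡ x + + 2 * (- (+ 1 + y))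
  shift-down = solve-∀

shift-by-evens : (P : ℤ → Set) → (∀ x → P x → P (x + + 2)) → (∀ x → P x → P (x - + 2)) →
                 ∀ x q → P x → P (x + + 2 * q)
shift-by-evens P up down x q Px = shift q
  where
  ups : ∀ a → P (x + + 2 * + a)
  ups zero    = subst P (no-shift x) Px
  ups (suc a) = subst P (shift-up x (+ a)) (up _ (ups a))
  downs : ∀ a → P (x + + 2 * (- + a))
  downs zero    = subst P (no-shift x) Px
  downs (suc a) = subst P (shift-down x (+ a)) (down _ (downs a))
  shift : ∀ q → P (x + + 2 * q)
  shift (+ a)    = ups a
  shift -[1+ a ] = downs (suc a)

parity-closed : ∀ {n} (P : Pred (Vec ℤ n) 0ℓ) →
                (∀ i V → P V → P (updateAt V i (_+ + 2))) → (∀ i V → P V → P (updateAt V i (_- + 2))) →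
                ∀ V W → parity V ≡ parity W → P V → P W
parity-closed P up down []      []      _ PV = PV
parity-closed P up down (v ∷ V) (w ∷ W) e PV with same-parity v w (VecP.∷-injectiveˡ e)
... | q , refl = parity-closed (λ X → P (v + + 2 * q ∷ X)) (λ i X → up (suc i) _) (λ i X → down (suc i) _)
                   V W (VecP.∷-injectiveʳ e)
                   (shift-by-evens (λ x → P (x ∷ V)) (λ x → up zero (x ∷ V)) (λ x → down zero (x ∷ V)) v q PV)

periodic : ∀ {n} {L : Pred (Vec ℤ n) 0ℓ} → HalfTiling n L → ∀ J J' → parity J ≡ parity J' → L J → L J'
periodic {L = L} tiles = parity-closed L (jump-up tiles) (jump-down tiles)

Codewords : ∀ {n} → Pred (Vec ℤ n) 0ℓ → Pred (Word n) 0ℓ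
Codewords L w = L (bits w)

lift-codewords : ∀ {n} {L : Pred (Vec ℤ n) 0ℓ} → HalfTiling n L → SameElems (Lift (Codewords L)) L
lift-codewords tiles =
  (λ J → periodic tiles (bits (parity J)) J (parity-bits (parity J))) ,
  (λ J → periodic tiles J (bits (parity J)) (sym (parity-bits (parity J))))

-- The code of a half-tiling is perfect: the neighbourhood of bits w contains a
-- lifted codeword within distance 1 of w, and two codewords at distance ≤ 2 would
-- give two members of L in the neighbourhood of a lifted common neighbour.
codewords-perfect : ∀ {n} {L : Pred (Vec ℤ n) 0ℓ} → HalfTiling n L → IsPerfectCode n (Codewords L)
codewords-perfect {n} {L} tiles@(cover , unique) = separated , covering
  where
  offsets : Word n
  offsets = replicate n false
  near-bits : ∀ m w → hamming m w ℕ.≤ 1 → hamming (parity (bits m)) w ℕ.≤ 1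
  near-bits m w = subst (λ u → hamming u w ℕ.≤ 1) (sym (parity-bits m))
  covering : ∀ w → ∃ λ c → Codewords L c × hamming w c ℕ.≤ 1
  covering w with cover (bits w) offsets
  ... | J , LJ , N = parity J , proj₂ (lift-codewords tiles) J LJ ,
        subst (λ u → hamming u (parity J) ℕ.≤ 1) (parity-bits w) (neighbour-parity (bits w) offsets J N)
  separated : ∀ x y → Codewords L x → Codewords L y → x ≢ y → 3 ℕ.≤ hamming x y
  separated x y Lx Ly x≢y with 3 ℕ.≤? hamming x y
  ... | yes far = far
  ... | no near with midpoint x y (s≤s⁻¹ (ℕP.≰⇒> near))
  ... | m , mx , my with neighbour-with-parity (bits m) offsets x (near-bits m x mx)
                       | neighbour-with-parity (bits m) offsets y (near-bits m y my)
  ... | J , N , refl | J' , N' , refl = ⊥-elim (x≢y (cong parity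
          (unique (bits m) offsets J J' (proj₁ (lift-codewords tiles) J Lx) (proj₁ (lift-codewords tiles) J' Ly) N N')))

perfectCodes⤖evenTilings : ∀ n → Bijection (PerfectCodes n) (EvenTilings n)
perfectCodes⤖evenTilings n = record
  { to        = λ (C , perfect) → Doubled (Lift C) , doubled-tiling (Lift C) (lift-halfTiling C perfect)
  ; cong      = doubled-cong ∘ lift-cong
  ; bijective = (λ {x} {y} → injective {x} {y}) , surjective
  }
  where
  Code : Set₁
  Code = Σ (Pred (Word n) 0ℓ) (IsPerfectCode n)
  recovered : ∀ {C C' : Pred (Word n) 0ℓ} → (∀ X → Doubled (Lift C) X → Doubled (Lift C') X) → ∀ w → C w → C' w
  recovered {C} {C'} 2LC⊆2LC' w Cw with 2LC⊆2LC' (double (bits w)) (bits w , subst C (sym (parity-bits w)) Cw , refl)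
  ... | J , C'J , 2w≡2J = subst C' (parity-bits w) (subst (Lift C') (sym (double-injective (bits w) J 2w≡2J)) C'J)
  injective : ∀ {x y : Code} → SameElems (Doubled (Lift (proj₁ x))) (Doubled (Lift (proj₁ y))) → SameElems (proj₁ x) (proj₁ y)
  injective (⊆ , ⊇) = recovered ⊆ , recovered ⊇
  surjective : ∀ (y : Σ (Pred (Point n) 0ℓ) (IsEvenTiling n)) → Σ Code λ x →
               ∀ {z : Code} → SameElems (proj₁ z) (proj₁ x) → SameElems (Doubled (Lift (proj₁ z))) (proj₁ y)
  surjective (T , tiling) = (Codewords (Halved T) , codewords-perfect halves) , λ z≈ →
    same-trans (doubled-cong (same-trans (lift-cong z≈) (lift-codewords halves))) (doubled-halved T tiling)
    where
    halves : HalfTiling n (Halved T)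
    halves = halved-tiling T tiling

-- Theorem 6.  The correspondence holds for every length n; in particular for
-- n = 2ᵗ - 1, the lengths for which perfect codes exist.
theorem6 : (t : ℕ) → 0 < t →
    Bijection (PerfectCodes (2 ^ t ∸ 1)) (EvenTilings (2 ^ t ∸ 1))
theorem6 t _ = perfectCodes⤖evenTilings (2 ^ t ∸ 1)
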